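{- Let $D$ be a domain. Then for every $d\in D$, $d=\bigsqcup\mathrm{Ir}(d)$, where $\mathrm{Ir}(d)$ is the set of irreducibles of $D$ below $d$.
   Context: A subset of a partial order is pairwise consistent if every two of its elements have an upper bound. An element $d$ is compact if $d\sqsubseteq\bigsqcup X$ for a directed $X$ implies $d\sqsubseteq x$ for some $x\in X$; $K(D)$ is the set of compacts. A domain is a partial order in which every pairwise consistent subset has a least upper bound, every element $x$ equals $\bigsqcup\{c\in K(D)\mid c\sqsubseteq x\}$, and every compact has finitely many elements below it. An irreducible is an $i\in K(D)$ such that for every pairwise consistent $X\subseteq K(D)$, $i=\bigsqcup X$ implies $i\in X$. -}

module Defs where

open import Level using (Level; _⊔_; suc)
open import Data.Product using (Σ; ∃; _×_; _,_)
open import Data.List using (List)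
open import Data.List.Relation.Unary.Any using (Any)
open import Relation.Unary using (Pred)
open import Relation.Binary.Bundles using (Poset)

module DomainTheory {c ℓ₁ ℓ₂ : Level} (P : Poset c ℓ₁ ℓ₂) where
  open Poset P renaming (Carrier to D)

  _∈ₑ_ : ∀ {ℓ} → D → Pred D ℓ → Set (c ⊔ ℓ₁ ⊔ ℓ)
  x ∈ₑ X = ∃ λ y → X y × y ≈ x

  IsUpperBound : ∀ {ℓ} → Pred D ℓ → D → Set (c ⊔ ℓ₂ ⊔ ℓ)
  IsUpperBound X u = ∀ x → X x → x ≤ u

  IsLub : ∀ {ℓ} → Pred D ℓ → D → Set (c ⊔ ℓ₂ ⊔ ℓ)
  IsLub X u = IsUpperBound X u × (∀ v → IsUpperBound X v → u ≤ v)

  PairwiseConsistent : ∀ {ℓ} → Pred D ℓ → Set (c ⊔ ℓ₂ ⊔ ℓ)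
  PairwiseConsistent X = ∀ x y → X x → X y → ∃ λ u → x ≤ u × y ≤ u

  Directed : ∀ {ℓ} → Pred D ℓ → Set (c ⊔ ℓ₂ ⊔ ℓ)
  Directed X = (∃ λ x → X x) ×
               (∀ x y → X x → X y → ∃ λ z → X z × x ≤ z × y ≤ z)

  module _ (ℓ : Level) where
    Compact : D → Set (c ⊔ ℓ₂ ⊔ suc ℓ)
    Compact d = (X : Pred D ℓ) → Directed X → (s : D) → IsLub X s → d ≤ s →
                ∃ λ x → X x × d ≤ x

    -- "finitely many elements below d": a finite list containing (up to ≈)
    -- every element below d
    FinitelyBelow : D → Set (c ⊔ ℓ₁ ⊔ ℓ₂)
    FinitelyBelow d = ∃ λ (xs : List D) → ∀ y → y ≤ d → Any (y ≈_) xs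

    Irreducible : D → Set (c ⊔ ℓ₁ ⊔ ℓ₂ ⊔ suc ℓ)
    Irreducible i = Compact i ×
      ((X : Pred D ℓ) → (∀ x → X x → Compact x) → PairwiseConsistent X →
       IsLub X i → i ∈ₑ X)

    Ir : D → Pred D (c ⊔ ℓ₁ ⊔ ℓ₂ ⊔ suc ℓ)
    Ir d i = Irreducible i × i ≤ d

    record IsDomain : Set (c ⊔ ℓ₁ ⊔ ℓ₂ ⊔ suc ℓ) where
      field
        consistentLub : (X : Pred D ℓ) → PairwiseConsistent X → ∃ λ s → IsLub X s
        algebraic     : ∀ x → IsLub (λ k → Compact k × k ≤ x) x
        finiteBelow   : ∀ k → Compact k → FinitelyBelow k

-- Fix d and an upper bound v of Ir(d). By algebraicity it suffices that every compact k ⊑ d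
-- lies below v. Since only finitely many elements lie below k, the strict order is
-- well-founded there; take a ⊑-minimal compact x ⊑ k with x ⋢ v. If x = ⊔X for compacts X
-- and x ∉ X, every member of X is strictly below x, hence below v, and so is x. Thus x is
-- irreducible, so x ∈ Ir(d) and x ⊑ v after all.
module Submission where

open import Defs
open import Level using (Level; _⊔_; suc; Lift; lift; lower)
open import Relation.Binary.Bundles using (Poset)
open import Relation.Binary.Definitions using (Decidable)
open import Axiom.ExcludedMiddle using (ExcludedMiddle)
open import Data.Nat using (ℕ; z≤n; s≤s) renaming (_≤_ to _≤ℕ_; _<_ to _<ℕ_)
open import Data.Nat.Properties using (m≤n⇒m≤1+n)
open import Data.Nat.Induction using (<-wellFounded)
open import Induction.WellFounded using (Acc; acc)
open import Data.List using (List; []; _∷_; length; filter)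
open import Data.List.Relation.Unary.Any as Any using (Any; here; there)
open import Data.Product using (_×_; _,_; proj₁; proj₂)
open import Relation.Unary using (Pred; _⊆_)
import Relation.Unary as U
open import Relation.Nullary using (yes; no; ¬_)
open import Relation.Nullary.Decidable using (map′)
open import Data.Empty using (⊥-elim)
import Relation.Binary.Properties.Poset as PosetProperties

excludedMiddle-lower : ∀ {a b} → ExcludedMiddle (a ⊔ b) → ExcludedMiddle a
excludedMiddle-lower {b = b} em = map′ lower lift (em {Lift b _})

module _ {a p q} {A : Set a} {P : Pred A p} {Q : Pred A q}
         (P? : U.Decidable P) (Q? : U.Decidable Q) (P⊆Q : P ⊆ Q) where

  length-filter-mono : ∀ xs → length (filter P? xs) ≤ℕ length (filter Q? xs)
  length-filter-mono []       = z≤n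
  length-filter-mono (x ∷ xs) with P? x | Q? x
  ... | yes _  | yes _ = s≤s (length-filter-mono xs)
  ... | yes px | no ¬qx = ⊥-elim (¬qx (P⊆Q px))
  ... | no _   | yes _ = m≤n⇒m≤1+n (length-filter-mono xs)
  ... | no _   | no _  = length-filter-mono xs

  length-filter-strict : ∀ {xs} → Any (λ x → Q x × ¬ P x) xs →
                         length (filter P? xs) <ℕ length (filter Q? xs)
  length-filter-strict {x ∷ xs} any with P? x | Q? x | any
  ... | yes px | _      | here (_ , ¬px) = ⊥-elim (¬px px)
  ... | yes _  | yes _  | there any′     = s≤s (length-filter-strict any′)
  ... | yes px | no ¬qx | _              = ⊥-elim (¬qx (P⊆Q px))
  ... | no _   | yes _  | _              = s≤s (length-filter-mono xs)
  ... | no _   | no ¬qx | here (qx , _)  = ⊥-elim (¬qx qx)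
  ... | no _   | no _   | there any′     = length-filter-strict any′

module _ {c ℓ₁ ℓ₂ : Level} (ℓ : Level) (P : Poset c ℓ₁ ℓ₂) where
  open Poset P renaming (Carrier to D)
  open PosetProperties P using (_<_; ≤∧≉⇒<; <⇒≱)
  open DomainTheory P

  module _ (_≤?_ : Decidable _≤_) where

    rank : List D → D → ℕ
    rank es x = length (filter (_≤? x) es)

    rank-strict : ∀ {es x y} → Any (x ≈_) es → y < x → rank es y <ℕ rank es x
    rank-strict {x = x} {y} x∈es y<x =
      length-filter-strict (_≤? y) (_≤? x) (λ e≤y → trans e≤y (proj₁ y<x))
                           (Any.map witness x∈es)
      where
      witness : ∀ {e} → x ≈ e → e ≤ x × ¬ e ≤ y
      witness x≈e = reflexive (Eq.sym x≈e) , λ e≤y → <⇒≱ y<x (trans (reflexive x≈e) e≤y)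

    <-rec-below : ∀ {k q} → FinitelyBelow ℓ k → (Q : Pred D q) →
                  (∀ x → x ≤ k → (∀ y → y < x → Q y) → Q x) →
                  ∀ x → x ≤ k → Q x
    <-rec-below {k} (es , cover) Q step x x≤k = go x (<-wellFounded (rank es x)) x≤k
      where
      go : ∀ x → Acc _<ℕ_ (rank es x) → x ≤ k → Q x
      go x (acc rs) x≤k = step x x≤k λ y y<x →
        go y (rs (rank-strict (cover x x≤k) y<x)) (trans (proj₁ y<x) x≤k)

  ∉ₑ-upperBound⇒< : ∀ {ℓ′} {X : Pred D ℓ′} {x y} →
                    IsUpperBound X x → ¬ x ∈ₑ X → X y → y < x
  ∉ₑ-upperBound⇒< ub x∉X Xy = ≤∧≉⇒< (ub _ Xy) λ y≈x → x∉X (_ , Xy , y≈x)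

  module _ (em : ExcludedMiddle (c ⊔ ℓ₁ ⊔ ℓ₂ ⊔ suc ℓ)) where

    L : Level
    L = c ⊔ ℓ₁ ⊔ ℓ₂ ⊔ suc ℓ

    _≤?_ : Decidable _≤_
    x ≤? y = excludedMiddle-lower {b = L} em

    minimal-≰-irreducible : ∀ {x v} → Compact ℓ x → ¬ x ≤ v →
                            (∀ y → y < x → Compact ℓ y → y ≤ v) → Irreducible ℓ x
    minimal-≰-irreducible {x} {v} x-compact x≰v below = x-compact , lub-∈ₑ
      where
      lub-∈ₑ : (X : Pred D ℓ) → (∀ y → X y → Compact ℓ y) → PairwiseConsistent X →
               IsLub X x → x ∈ₑ X
      lub-∈ₑ X X-compact _ (ub , least) with excludedMiddle-lower {b = L} em
      ... | yes x∈X = x∈X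
      ... | no x∉X  = ⊥-elim (x≰v (least v λ y Xy →
                        below y (∉ₑ-upperBound⇒< ub x∉X Xy) (X-compact y Xy)))

    module _ (domain : IsDomain ℓ) where
      open IsDomain domain

      compact-below-upperBound-Ir : ∀ {d v} → IsUpperBound (Ir ℓ d) v →
                                    ∀ k → Compact ℓ k → k ≤ d → k ≤ v
      compact-below-upperBound-Ir {d} {v} ub k k-compact k≤d =
        <-rec-below _≤?_ (finiteBelow k k-compact) (λ x → Compact ℓ x → x ≤ v)
                    step k refl k-compact
        where
        step : ∀ x → x ≤ k → (∀ y → y < x → Compact ℓ y → y ≤ v) → Compact ℓ x → x ≤ v
        step x x≤k below x-compact with x ≤? v
        ... | yes x≤v = x≤v
        ... | no x≰v  = ub x (minimal-≰-irreducible x-compact x≰v below , trans x≤k k≤d)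

mainTheorem8 : {c ℓ₁ ℓ₂ : Level} (ℓ : Level) (P : Poset c ℓ₁ ℓ₂) →
    ExcludedMiddle (c ⊔ ℓ₁ ⊔ ℓ₂ ⊔ suc ℓ) →
    DomainTheory.IsDomain P ℓ →
    (d : Poset.Carrier P) → DomainTheory.IsLub P (DomainTheory.Ir P ℓ d) d
mainTheorem8 ℓ P em domain d =
  (λ i i∈Ir → proj₂ i∈Ir) ,
  λ v ub → proj₂ (algebraic d) v λ k (k-compact , k≤d) →
    compact-below-upperBound-Ir ℓ P em domain ub k k-compact k≤d
  where open DomainTheory.IsDomain domain
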